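{- Let $G$ be a finite digraph with blocks $B_1,\dots,B_k$, and suppose $G$ has $t$ cut-vertices $v^c_1,\dots,v^c_t$ with cut-indices $T(1),T(2),\dots,T(t)$, respectively. Then the number of $\mathcal{B}$-partitions of $G$ is $$\prod_{i=1}^{t} T(i).$$
   Context: A digraph $G=(V(G),E(G))$ consists of a finite vertex set $V(G)$ and an edge set $E(G)\subseteq V(G)\times V(G)$ (loops $(u,u)$ allowed). A subdigraph $H$ of $G$ has $V(H)\subseteq V(G)$, $E(H)\subseteq E(G)$; it is induced if whenever $u,v\in V(H)$ and $(u,v)\in E(G)$ then $(u,v)\in E(H)$. A digraph with empty vertex set is a null graph. A path between $v_1$ and $v_k$ is a sequence of distinct vertices $v_1,\dots,v_k$ such that for each $i$, $(v_i,v_{i+1})\in E(G)$ or $(v_{i+1},v_i)\in E(G)$ (edge directions are ignored); $G$ is connected if any two distinct vertices are joined by a path. A component is a maximal connected subdigraph. A cut-vertex of $G$ is a vertex whose removal increases the number of components. A block of $G$ is a maximal connected subdigraph of $G$ that has no cut-vertex. The cut-index of a cut-vertex $v$ is the number of blocks of $G$ containing $v$. If $G$ has blocks $B_1,\dots,B_k$, a $\mathcal{B}$-partition of $G$ is a partition of $G$ into $k$ vertex-disjoint induced subdigraphs $\hat B_1,\dots,\hat B_k$ (whose vertex sets partition $V(G)$; some may be null graphs) such that $\hat B_i$ is an (induced) subdigraph of $B_i$ for each $i=1,\dots,k$. -}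

module Defs where

open import Data.Nat using (ℕ; zero; suc; _*_; _<_)
open import Data.Bool using (Bool; true; false)
open import Data.Fin using (Fin)
open import Data.Fin.Subset using (Subset; _∈_; _⊆_; ⊤)
open import Data.Fin.Subset.Properties using (_∈?_)
open import Data.Fin.Properties using (_≟_)
open import Data.Vec using (Vec; []; _∷_; lookup; tabulate; count; foldr)
open import Data.List using (List; []; _∷_; length)
open import Data.List.Relation.Unary.All using (All)
open import Data.List.Relation.Unary.Unique.Propositional using (Unique)
import Data.List.Membership.Propositional as LM
open import Data.Product using (Σ; ∃; _×_; _,_)
open import Data.Sum using (_⊎_)
open import Relation.Binary.PropositionalEquality using (_≡_; _≢_)
open import Relation.Nullary using (¬_; yes; no)

-- Digraphs on the vertex set Fin n.  An edge set is an n×n Boolean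
-- adjacency matrix (loops allowed); (u , v) is an edge iff entry u v is true.

EdgeSet : ℕ → Set
EdgeSet n = Vec (Vec Bool n) n

_∈E_ : ∀ {n} → Fin n × Fin n → EdgeSet n → Set
(u , v) ∈E F = lookup (lookup F u) v ≡ true

Digraph : ℕ → Set
Digraph n = EdgeSet n

record SubDigraph (n : ℕ) : Set where
  constructor mkSub
  field
    verts : Subset n
    edges : EdgeSet n
open SubDigraph public

whole : ∀ {n} → Digraph n → SubDigraph n
whole G = mkSub ⊤ G

IsSubOf : ∀ {n} → SubDigraph n → SubDigraph n → Set
IsSubOf {n} H K =
  (verts H ⊆ verts K)
  × (∀ (u v : Fin n) → (u , v) ∈E edges H → (u , v) ∈E edges K)
  × (∀ (u v : Fin n) → (u , v) ∈E edges H → (u ∈ verts H) × (v ∈ verts H))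

IsInducedSubOf : ∀ {n} → SubDigraph n → SubDigraph n → Set
IsInducedSubOf {n} H K =
  IsSubOf H K
  × (∀ (u v : Fin n) → u ∈ verts H → v ∈ verts H →
       (u , v) ∈E edges K → (u , v) ∈E edges H)

Adj : ∀ {n} → SubDigraph n → Fin n → Fin n → Set
Adj H u w = ((u , w) ∈E edges H) ⊎ ((w , u) ∈E edges H)

data Chain {n} (H : SubDigraph n) : Fin n → Fin n → List (Fin n) → Set where
  single : ∀ {u} → u ∈ verts H → Chain H u u (u ∷ [])
  step   : ∀ {u w v xs} → u ∈ verts H → Adj H u w →
           Chain H w v xs → Chain H u v (u ∷ xs)

Path : ∀ {n} → SubDigraph n → Fin n → Fin n → Set
Path {n} H u v = Σ (List (Fin n)) λ xs → Chain H u v xs × Unique xs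

Connected : ∀ {n} → SubDigraph n → Set
Connected {n} H = ∀ (u v : Fin n) → u ∈ verts H → v ∈ verts H → u ≢ v → Path H u v

_⊑_ : ∀ {n} → SubDigraph n → SubDigraph n → Set
_⊑_ {n} H K = (verts H ⊆ verts K)
            × (∀ (u v : Fin n) → (u , v) ∈E edges H → (u , v) ∈E edges K)

IsComponent : ∀ {n} → SubDigraph n → SubDigraph n → Set
IsComponent H C =
  IsSubOf C H × Connected C
  × (∀ C' → IsSubOf C' H → Connected C' → C ⊑ C' → C ≡ C')

NumComponents : ∀ {n} → SubDigraph n → ℕ → Set
NumComponents {n} H c =
  Σ (List (SubDigraph n)) λ L →
    Unique L × All (IsComponent H) L
    × (∀ C → IsComponent H C → C LM.∈ L) × length L ≡ c

removeV : ∀ {n} → SubDigraph n → Fin n → SubDigraph n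
removeV H v =
  mkSub (tabulate λ x → keep x (lookup (verts H) x))
        (tabulate λ x → tabulate λ y → keep x (keep y (lookup (lookup (edges H) x) y)))
  where
    keep : _ → Bool → Bool
    keep x b with x ≟ v
    ... | yes _ = false
    ... | no _  = b

IsCutVertex : ∀ {n} → SubDigraph n → Fin n → Set
IsCutVertex H v =
  v ∈ verts H
  × Σ ℕ λ c → Σ ℕ λ c' → NumComponents H c × NumComponents (removeV H v) c' × c < c'

NoCutVertex : ∀ {n} → SubDigraph n → Set
NoCutVertex {n} H = ∀ (v : Fin n) → ¬ IsCutVertex H v

IsBlock : ∀ {n} → Digraph n → SubDigraph n → Set
IsBlock G B =
  IsSubOf B (whole G) × Connected B × NoCutVertex B
  × (∀ B' → IsSubOf B' (whole G) → Connected B' → NoCutVertex B' → B ⊑ B' → B ≡ B')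

AreTheBlocks : ∀ {n k} → Digraph n → Vec (SubDigraph n) k → Set
AreTheBlocks {n} {k} G Bs =
  (∀ (i : Fin k) → IsBlock G (lookup Bs i))
  × (∀ B → IsBlock G B → ∃ λ (i : Fin k) → lookup Bs i ≡ B)
  × (∀ (i j : Fin k) → lookup Bs i ≡ lookup Bs j → i ≡ j)

AreTheCutVertices : ∀ {n t} → Digraph n → Vec (Fin n) t → Set
AreTheCutVertices {n} {t} G cs =
  (∀ (i : Fin t) → IsCutVertex (whole G) (lookup cs i))
  × (∀ v → IsCutVertex (whole G) v → ∃ λ (i : Fin t) → lookup cs i ≡ v)
  × (∀ (i j : Fin t) → lookup cs i ≡ lookup cs j → i ≡ j)

cutIndex : ∀ {n k} → Vec (SubDigraph n) k → Fin n → ℕ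
cutIndex Bs v = count (λ B → v ∈? verts B) Bs

prodV : ∀ {m} → Vec ℕ m → ℕ
prodV = foldr _ _*_ 1

IsBPartition : ∀ {n k} → Digraph n → Vec (SubDigraph n) k → Vec (SubDigraph n) k → Set
IsBPartition {n} {k} G Bs P =
  (∀ (i : Fin k) → IsInducedSubOf (lookup P i) (whole G))
  × (∀ (i : Fin k) → IsInducedSubOf (lookup P i) (lookup Bs i))
  × (∀ (v : Fin n) → ∃ λ (i : Fin k) →
        (v ∈ verts (lookup P i)) × (∀ (j : Fin k) → v ∈ verts (lookup P j) → j ≡ i))

NumBPartitions : ∀ {n k} → Digraph n → Vec (SubDigraph n) k → ℕ → Set
NumBPartitions {n} {k} G Bs m =
  Σ (List (Vec (SubDigraph n) k)) λ L →
    Unique L × All (IsBPartition G Bs) L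
    × (∀ P → IsBPartition G Bs P → P LM.∈ L) × length L ≡ m

-- Write T(v) for the number of blocks containing a vertex v.  A B-partition is the same as a
-- choice, for every vertex v, of one of the T(v) blocks containing it: the i-th part is the
-- subdigraph of B_i induced by the vertices that chose B_i.  This uses that blocks are induced
-- subdigraphs of G, and gives prod_v T(v) B-partitions.  Every vertex lies in some block, and a
-- vertex v in two distinct blocks is a cut-vertex: otherwise a path between the blocks avoiding v
-- would merge them into a larger subdigraph without cut-vertex.  Hence T(v) = 1 off the
-- cut-vertices.  These graph-theoretic facts are proved in the double-negation monad; their
-- consequences used for counting are decidable, hence hold outright.
module Submission where

open import Defs
open import Data.Nat using (ℕ; zero; suc; _+_; _*_; _<_; _≤_; z≤n; s≤s)
open import Data.Nat.Properties
  using (≤-refl; ≤-reflexive; ≤-trans; ≤-antisym; <-≤-trans; <⇒≱; m≤n+m; +-suc; +-identityʳ;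
         +-mono-≤; +-monoˡ-≤; +-mono-≤-<; +-mono-<-≤)
open import Data.Nat.ListAction using (product)
open import Data.Nat.ListAction.Properties using (product-↭)
open import Data.Bool using (Bool; true; false; _∧_)
import Data.Bool.Properties as Bool
open import Data.Empty using (⊥-elim)
open import Data.Fin using (Fin; zero; suc)
open import Data.Fin.Properties using (_≟_; suc-injective) renaming (any? to anyFin?)
open import Data.Fin.Subset using (Subset; _∈_; _⊆_; _⊂_; ∣_∣; ⁅_⁆; _∪_) renaming (⊥ to ∅)
open import Data.Fin.Subset.Properties
  using (_∈?_; ∈⊤; ∉⊥; ⊆-antisym; ∣p∣≤n; p⊆q⇒∣p∣≤∣q∣; p⊂q⇒∣p∣<∣q∣; x∈⁅x⁆; x∈⁅y⁆⇒x≡y; x∈p∪q⁺; x∈p∪q⁻)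
open import Data.Product using (Σ; ∃; _×_; _,_; proj₁; proj₂)
open import Data.Sum as Sum using (_⊎_; inj₁; inj₂)
open import Data.List as List using (List; []; _∷_; _++_; length; filter; cartesianProductWith; deduplicate)
import Data.List.Properties as List
open import Data.List.Properties using (length-++; length-map)
open import Data.List.Membership.Propositional using () renaming (_∈_ to _∈ˡ_; _∉_ to _∉ˡ_)
open import Data.List.Membership.Propositional.Properties
  using (∈-allFin; ∈-tabulate⁺; ∈-map⁺; ∈-map⁻; ∈-cartesianProductWith⁺; ∈-cartesianProductWith⁻;
         ∈-deduplicate⁺; ∈-deduplicate⁻; ∈-∃++; ∈-filter⁺; ∈-filter⁻)
open import Data.List.Relation.Binary.Permutation.Propositional using (↭-sym; ↭⇒↭ₛ)
open import Data.List.Relation.Binary.Permutation.Propositional.Properties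
  using (∈-resp-↭; ↭-length; shift) renaming (map⁺ to ↭-map⁺)
import Data.List.Relation.Binary.Permutation.Setoid.Properties as PermutationSetoid
open import Data.List.Relation.Unary.Any using (here; there; any?)
open import Data.List.Relation.Unary.All as All using (All; []; _∷_)
open import Data.List.Relation.Unary.All.Properties using (¬Any⇒All¬)
open import Data.List.Relation.Unary.AllPairs as AllPairs using ([]; _∷_)
open import Data.List.Relation.Unary.Unique.Propositional using (Unique)
import Data.List.Relation.Unary.Unique.Propositional.Properties as Unique
open import Data.List.Relation.Unary.Unique.Propositional.Properties
  using (filter⁺; cartesianProductWith⁺; tabulate⁺; allFin⁺)
import Data.List.Relation.Unary.Unique.DecPropositional.Properties as UniqueDec
open import Data.Vec using (Vec; []; _∷_; lookup; tabulate; replicate; map)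
open import Data.Vec.Properties
  using (∷-injective; ≡-dec; lookup∘tabulate; lookup-replicate; tabulate∘lookup; tabulate-cong; []=⇒lookup; lookup⇒[]=)
open import Function using (_∘_; id)
open import Relation.Binary.PropositionalEquality
open import Relation.Nullary using (¬_; Dec; yes; no; does)
open import Relation.Nullary.Decidable using (dec-true; map′; ¬?; _×-dec_; decidable-stable; ¬¬-excluded-middle)
open import Relation.Nullary.Negation using (¬¬-Monad)
open import Effect.Monad using (RawMonad)
open import Level using (0ℓ)

private variable
  n : ℕ
  a b u v w x y z : Fin n
  T : Subset n
  b′ : Bool
  H K : SubDigraph n

open RawMonad (¬¬-Monad {a = 0ℓ}) using (return; _>>=_)

¬¬-∀-Fin : ∀ m {P : Fin m → Set} → (∀ i → ¬ ¬ P i) → ¬ ¬ (∀ i → P i)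
¬¬-∀-Fin zero    _  = return λ ()
¬¬-∀-Fin (suc m) ¬¬P = do
  p₀ ← ¬¬P zero
  ps ← ¬¬-∀-Fin m (λ i → ¬¬P (suc i))
  return λ { zero → p₀ ; (suc i) → ps i }

¬¬-→ : ∀ {A B : Set} → (A → ¬ ¬ B) → ¬ ¬ (A → B)
¬¬-→ f k = k λ a → ⊥-elim (f a λ b → k λ _ → b)

vec-ext : ∀ {A : Set} {m} {xs ys : Vec A m} → (∀ i → lookup xs i ≡ lookup ys i) → xs ≡ ys
vec-ext {xs = xs} {ys} h = begin
  xs                   ≡⟨ sym (tabulate∘lookup xs) ⟩
  tabulate (lookup xs) ≡⟨ tabulate-cong h ⟩
  tabulate (lookup ys) ≡⟨ tabulate∘lookup ys ⟩
  ys                   ∎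
  where open ≡-Reasoning

true-ext : ∀ {p q : Bool} → (p ≡ true → q ≡ true) → (q ≡ true → p ≡ true) → p ≡ q
true-ext {false} {false} _ _ = refl
true-ext {false} {true}  _ g = g refl
true-ext {true}  {false} f _ = sym (f refl)
true-ext {true}  {true}  _ _ = refl

⊆∧≢⇒⊂ : {p q : Subset n} → p ⊆ q → p ≢ q → p ⊂ q
⊆∧≢⇒⊂ {p = p} {q} p⊆q p≢q with anyFin? (λ x → x ∈? q ×-dec ¬? (x ∈? p))
... | yes (x , x∈q , x∉p) = p⊆q , x , x∈q , x∉p
... | no  none            = ⊥-elim (p≢q (⊆-antisym p⊆q q⊆p))
  where
  q⊆p : q ⊆ p
  q⊆p {x} x∈q with x ∈? p
  ... | yes x∈p = x∈p
  ... | no  x∉p = ⊥-elim (none (x , x∈q , x∉p))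

toSubset : List (Fin n) → Subset n
toSubset = List.foldr (λ x T → ⁅ x ⁆ ∪ T) ∅

∈-toSubset⁺ : ∀ {xs} → x ∈ˡ xs → x ∈ toSubset xs
∈-toSubset⁺ {x = x} (here refl) = x∈p∪q⁺ (inj₁ (x∈⁅x⁆ x))
∈-toSubset⁺ (there x∈)           = x∈p∪q⁺ (inj₂ (∈-toSubset⁺ x∈))

∈-toSubset⁻ : ∀ xs → x ∈ toSubset xs → x ∈ˡ xs
∈-toSubset⁻ []       x∈ = ⊥-elim (∉⊥ x∈)
∈-toSubset⁻ (y ∷ xs) x∈ with x∈p∪q⁻ ⁅ y ⁆ (toSubset xs) x∈
... | inj₁ x∈⁅y⁆ = here (x∈⁅y⁆⇒x≡y y x∈⁅y⁆)
... | inj₂ x∈xs  = there (∈-toSubset⁻ xs x∈xs)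

Unique-⊆⇒length-≤ : ∀ {A : Set} {xs ys : List A} → Unique xs → (∀ {z} → z ∈ˡ xs → z ∈ˡ ys) →
                    length xs ≤ length ys
Unique-⊆⇒length-≤ {xs = []}     _            _     = z≤n
Unique-⊆⇒length-≤ {xs = x ∷ xs} (x∉xs ∷ uq) xs⊆ys with ∈-∃++ (xs⊆ys (here refl))
... | as , bs , refl = ≤-trans (s≤s (Unique-⊆⇒length-≤ uq xs⊆as++bs)) (≤-reflexive (sym (↭-length (shift x as bs))))
  where
  xs⊆as++bs : ∀ {z} → z ∈ˡ xs → z ∈ˡ as ++ bs
  xs⊆as++bs z∈xs with ∈-resp-↭ (shift x as bs) (xs⊆ys (there z∈xs))
  ... | here refl = ⊥-elim (All.lookup x∉xs z∈xs refl)
  ... | there z∈  = z∈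

length-≤1 : ∀ {A : Set} {xs : List A} → Unique xs → (∀ {a b} → a ∈ˡ xs → b ∈ˡ xs → a ≡ b) → length xs ≤ 1
length-≤1 {xs = []}    _  _     = z≤n
length-≤1 {xs = x ∷ _} uq const = Unique-⊆⇒length-≤ {ys = x ∷ []} uq λ z∈ → here (const z∈ (here refl))

∈⇒length-≥1 : ∀ {A : Set} {z : A} {xs} → z ∈ˡ xs → 1 ≤ length xs
∈⇒length-≥1 {xs = _ ∷ _} _ = s≤s z≤n

product-map-≡1 : ∀ {A : Set} (h : A → ℕ) xs → (∀ {z} → z ∈ˡ xs → h z ≡ 1) → product (List.map h xs) ≡ 1
product-map-≡1 h []       _   = refl
product-map-≡1 h (x ∷ xs) h≡1 = cong₂ _*_ (h≡1 (here refl)) (product-map-≡1 h xs (h≡1 ∘ there))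

product-map-⊆ : ∀ {A : Set} (h : A → ℕ) {xs} ys → Unique xs → Unique ys → (∀ {z} → z ∈ˡ ys → z ∈ˡ xs) →
                (∀ {z} → z ∈ˡ xs → z ∉ˡ ys → h z ≡ 1) → product (List.map h xs) ≡ product (List.map h ys)
product-map-⊆ h {xs} [] _ _ _ h≡1 = product-map-≡1 h xs λ z∈ → h≡1 z∈ λ ()
product-map-⊆ h (y ∷ ys) uq-xs (y∉ys ∷ uq-ys) ys⊆xs h≡1 with ∈-∃++ (ys⊆xs (here refl))
... | as , bs , refl = begin
  product (List.map h (as ++ y ∷ bs)) ≡⟨ product-↭ (↭-map⁺ h (shift y as bs)) ⟩
  h y * product (List.map h (as ++ bs)) ≡⟨ cong (h y *_) (product-map-⊆ h ys uq-rest uq-ys ys⊆rest h≡1′) ⟩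
  h y * product (List.map h ys)         ∎
  where
  open ≡-Reasoning
  uq-y∷rest : Unique (y ∷ as ++ bs)
  uq-y∷rest = PermutationSetoid.Unique-resp-↭ (setoid _) (↭⇒↭ₛ (shift y as bs)) uq-xs
  y∉rest : y ∉ˡ as ++ bs
  y∉rest y∈ = All.lookup (AllPairs.head uq-y∷rest) y∈ refl
  uq-rest : Unique (as ++ bs)
  uq-rest = AllPairs.tail uq-y∷rest
  ys⊆rest : ∀ {z} → z ∈ˡ ys → z ∈ˡ as ++ bs
  ys⊆rest z∈ys with ∈-resp-↭ (shift y as bs) (ys⊆xs (there z∈ys))
  ... | here refl = ⊥-elim (All.lookup y∉ys z∈ys refl)
  ... | there z∈  = z∈
  h≡1′ : ∀ {z} → z ∈ˡ as ++ bs → z ∉ˡ ys → h z ≡ 1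
  h≡1′ z∈ z∉ys = h≡1 (∈-resp-↭ (↭-sym (shift y as bs)) (there z∈))
                     λ { (here refl) → y∉rest z∈ ; (there z∈ys) → z∉ys z∈ys }

length-cartesianProductWith : ∀ {A B C : Set} (f : A → B → C) xs ys →
                              length (cartesianProductWith f xs ys) ≡ length xs * length ys
length-cartesianProductWith f []       ys = refl
length-cartesianProductWith f (x ∷ xs) ys = begin
  length (List.map (f x) ys ++ cartesianProductWith f xs ys)          ≡⟨ length-++ (List.map (f x) ys) ⟩
  length (List.map (f x) ys) + length (cartesianProductWith f xs ys) ≡⟨ cong₂ _+_ (length-map (f x) ys)
                                                                          (length-cartesianProductWith f xs ys) ⟩
  length ys + length xs * length ys                                   ∎
  where open ≡-Reasoning

choices : ∀ {A : Set} m → (Fin m → List A) → List (Vec A m)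
choices zero    _       = [] ∷ []
choices (suc m) options = cartesianProductWith _∷_ (options zero) (choices m (options ∘ suc))

length-choices : ∀ {A : Set} m (options : Fin m → List A) →
                 length (choices m options) ≡ product (List.tabulate (length ∘ options))
length-choices zero    _       = refl
length-choices (suc m) options =
  trans (length-cartesianProductWith _∷_ (options zero) (choices m (options ∘ suc)))
        (cong (length (options zero) *_) (length-choices m (options ∘ suc)))

∈-choices⁺ : ∀ {A : Set} m {options : Fin m → List A} (f : Vec A m) →
             (∀ i → lookup f i ∈ˡ options i) → f ∈ˡ choices m options
∈-choices⁺ zero    []      _ = here refl
∈-choices⁺ (suc m) (a ∷ f) f∈ = ∈-cartesianProductWith⁺ _∷_ (f∈ zero) (∈-choices⁺ m f (f∈ ∘ suc))

∈-choices⁻ : ∀ {A : Set} m {options : Fin m → List A} {f : Vec A m} →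
             f ∈ˡ choices m options → ∀ i → lookup f i ∈ˡ options i
∈-choices⁻ (suc m) {options} f∈ i with ∈-cartesianProductWith⁻ _∷_ (options zero) (choices m (options ∘ suc)) f∈
∈-choices⁻ (suc m) f∈ zero    | _ , _ , a∈ , _  , refl = a∈
∈-choices⁻ (suc m) f∈ (suc i) | _ , _ , _  , g∈ , refl = ∈-choices⁻ m g∈ i

choices-unique : ∀ {A : Set} m {options : Fin m → List A} → (∀ i → Unique (options i)) →
                 Unique (choices m options)
choices-unique zero    _  = [] ∷ []
choices-unique (suc m) uq = cartesianProductWith⁺ _∷_ ∷-injective (uq zero) (choices-unique m (uq ∘ suc))

¬¬-filter : ∀ {A : Set} (P : A → Set) (xs : List A) →
            ¬ ¬ Σ (List A) λ ys → All P ys × (∀ {y} → y ∈ˡ xs → P y → y ∈ˡ ys)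
¬¬-filter P []       = return ([] , [] , λ ())
¬¬-filter P (x ∷ xs) = do
  ys , all , complete ← ¬¬-filter P xs
  ¬¬-excluded-middle {A = P x} >>= λ where
    (yes px) → return (x ∷ ys , px ∷ all , λ { (here refl) _ → here refl ; (there y∈) py → there (complete y∈ py) })
    (no ¬px) → return (ys , all , λ { (here refl) px → ⊥-elim (¬px px) ; (there y∈) py → complete y∈ py })

-- Vertex and edge membership are wrapped in records so that Agda can infer the subdigraph.
record V (S : SubDigraph n) (x : Fin n) : Set where
  constructor mkV
  field unV : x ∈ verts S
open V public

record E (S : SubDigraph n) (a b : Fin n) : Set where
  constructor mkE
  field unE : (a , b) ∈E edges S
open E public

SubDigraph-ext : (∀ {x} → V H x → V K x) → (∀ {x} → V K x → V H x) →
                 (∀ {a b} → E H a b → E K a b) → (∀ {a b} → E K a b → E H a b) → H ≡ K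
SubDigraph-ext {H = mkSub vs es} {mkSub vt et} fV gV fE gE =
  cong₂ mkSub (⊆-antisym (λ p → unV (fV (mkV p))) (λ p → unV (gV (mkV p))))
              (vec-ext λ a → vec-ext λ b → true-ext (λ p → unE (fE (mkE p))) (λ p → unE (gE (mkE p))))

V? : (S : SubDigraph n) (x : Fin n) → Dec (V S x)
V? S x with x ∈? verts S
... | yes p = yes (mkV p)
... | no ¬p = no λ q → ¬p (unV q)

V-whole : {G : Digraph n} → V (whole G) x
V-whole = mkV ∈⊤

E? : (S : SubDigraph n) (a b : Fin n) → Dec (E S a b)
E? S a b = map′ mkE unE (lookup (lookup (edges S) a) b Bool.≟ true)

removeV-lookup : ∀ (H : SubDigraph n) v x → lookup (verts (removeV H v)) x ≡ b′ →
                 (x ≡ v × b′ ≡ false) ⊎ (x ≢ v × lookup (verts H) x ≡ b′)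
removeV-lookup H v x p with trans (sym (lookup∘tabulate _ x)) p
... | q with x ≟ v
... | yes x≡v = inj₁ (x≡v , sym q)
... | no x≢v  = inj₂ (x≢v , q)

removeV-edge-lookup : ∀ (H : SubDigraph n) v a b → lookup (lookup (edges (removeV H v)) a) b ≡ b′ →
                      ((a ≡ v ⊎ b ≡ v) × b′ ≡ false) ⊎ (a ≢ v × b ≢ v × lookup (lookup (edges H) a) b ≡ b′)
removeV-edge-lookup H v a b p
  with trans (sym (lookup∘tabulate _ b)) (trans (sym (cong (λ r → lookup r b) (lookup∘tabulate _ a))) p)
... | q with a ≟ v | b ≟ v
... | yes a≡v | _       = inj₁ (inj₁ a≡v , sym q)
... | no _    | yes b≡v = inj₁ (inj₂ b≡v , sym q)
... | no a≢v  | no b≢v  = inj₂ (a≢v , b≢v , q)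

removeV-V⁻ : V (removeV H v) x → x ≢ v × V H x
removeV-V⁻ {H = H} {v = v} {x = x} (mkV p) with removeV-lookup H v x ([]=⇒lookup p)
... | inj₁ (_ , ())
... | inj₂ (x≢v , q) = x≢v , mkV (lookup⇒[]= _ _ q)

removeV-V⁺ : x ≢ v → V H x → V (removeV H v) x
removeV-V⁺ {x = x} {v = v} {H = H} x≢v (mkV p) = mkV (lookup⇒[]= _ _ (Bool.¬-not excluded))
  where
  excluded : lookup (verts (removeV H v)) x ≢ false
  excluded q with removeV-lookup H v x q
  ... | inj₁ (x≡v , _) = x≢v x≡v
  ... | inj₂ (_ , q′) with trans (sym ([]=⇒lookup p)) q′
  ... | ()

removeV-E⁻ : E (removeV H v) a b → a ≢ v × b ≢ v × E H a b
removeV-E⁻ {H = H} {v = v} {a = a} {b = b} (mkE p) with removeV-edge-lookup H v a b p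
... | inj₁ (_ , ())
... | inj₂ (a≢v , b≢v , q) = a≢v , b≢v , mkE q

removeV-E⁺ : a ≢ v → b ≢ v → E H a b → E (removeV H v) a b
removeV-E⁺ {a = a} {v = v} {b = b} {H = H} a≢v b≢v (mkE p) = mkE (Bool.¬-not excluded)
  where
  excluded : lookup (lookup (edges (removeV H v)) a) b ≢ false
  excluded q with removeV-edge-lookup H v a b q
  ... | inj₁ (inj₁ a≡v , _) = a≢v a≡v
  ... | inj₁ (inj₂ b≡v , _) = b≢v b≡v
  ... | inj₂ (_ , _ , q′) with trans (sym p) q′
  ... | ()

record _≼_ (H K : SubDigraph n) : Set where
  constructor mk≼
  field
    ≼-V : ∀ {x} → V H x → V K x
    ≼-E : ∀ {a b} → E H a b → E K a b
open _≼_ public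

≼-refl : H ≼ H
≼-refl = mk≼ (λ p → p) (λ e → e)

≼-trans : {L : SubDigraph n} → H ≼ K → K ≼ L → H ≼ L
≼-trans H≼K K≼L = mk≼ (λ p → ≼-V K≼L (≼-V H≼K p)) (λ e → ≼-E K≼L (≼-E H≼K e))

≼-antisym : H ≼ K → K ≼ H → H ≡ K
≼-antisym H≼K K≼H = SubDigraph-ext (≼-V H≼K) (≼-V K≼H) (≼-E H≼K) (≼-E K≼H)

WellFormed : SubDigraph n → Set
WellFormed H = ∀ {a b} → E H a b → V H a × V H b

IsSubOf⇒≼ : IsSubOf H K → H ≼ K
IsSubOf⇒≼ (vs , es , _) = mk≼ (λ p → mkV (vs (unV p))) (λ e → mkE (es _ _ (unE e)))

IsSubOf⇒WellFormed : IsSubOf H K → WellFormed H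
IsSubOf⇒WellFormed (_ , _ , ends) (mkE e) = mkV (proj₁ (ends _ _ e)) , mkV (proj₂ (ends _ _ e))

≼⇒IsSubOf : WellFormed H → H ≼ K → IsSubOf H K
≼⇒IsSubOf wf H≼K =
  (λ p → unV (≼-V H≼K (mkV p))) , (λ _ _ e → unE (≼-E H≼K (mkE e))) ,
  (λ _ _ e → unV (proj₁ (wf (mkE e))) , unV (proj₂ (wf (mkE e))))

⊑⇒≼ : H ⊑ K → H ≼ K
⊑⇒≼ (vs , es) = mk≼ (λ p → mkV (vs (unV p))) (λ e → mkE (es _ _ (unE e)))

≼⇒⊑ : H ≼ K → H ⊑ K
≼⇒⊑ H≼K = (λ p → unV (≼-V H≼K (mkV p))) , (λ _ _ e → unE (≼-E H≼K (mkE e)))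

whole-WellFormed : {G : Digraph n} → WellFormed (whole G)
whole-WellFormed _ = V-whole , V-whole

removeV-≼ : removeV H v ≼ H
removeV-≼ = mk≼ (λ p → proj₂ (removeV-V⁻ p)) (λ e → proj₂ (proj₂ (removeV-E⁻ e)))

removeV-WellFormed : WellFormed H → WellFormed (removeV H v)
removeV-WellFormed wf e with removeV-E⁻ e
... | a≢v , b≢v , e′ = removeV-V⁺ a≢v (proj₁ (wf e′)) , removeV-V⁺ b≢v (proj₂ (wf e′))

removeV-mono : H ≼ K → removeV H v ≼ removeV K v
removeV-mono H≼K = mk≼
  (λ p → let x≢v , q = removeV-V⁻ p in removeV-V⁺ x≢v (≼-V H≼K q))
  (λ e → let a≢v , b≢v , e′ = removeV-E⁻ e in removeV-E⁺ a≢v b≢v (≼-E H≼K e′))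

induced : SubDigraph n → Subset n → SubDigraph n
induced H T = mkSub T (tabulate λ a → tabulate λ b → lookup T a ∧ (lookup T b ∧ lookup (lookup (edges H) a) b))

private
  ∧-true⁻ : ∀ p {q} → p ∧ q ≡ true → p ≡ true × q ≡ true
  ∧-true⁻ true q≡true = refl , q≡true

  lookup²∘tabulate² : ∀ {m} {A : Set} (f : Fin n → Fin m → A) a b →
                      lookup (lookup (tabulate λ a → tabulate (f a)) a) b ≡ f a b
  lookup²∘tabulate² f a b = trans (cong (λ r → lookup r b) (lookup∘tabulate _ a)) (lookup∘tabulate (f a) b)

induced-E⁻ : E (induced H T) a b → a ∈ T × b ∈ T × E H a b
induced-E⁻ {T = T} {a = a} {b = b} (mkE p)
  with ∧-true⁻ (lookup T a) (trans (sym (lookup²∘tabulate² _ a b)) p)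
... | a∈T , q with ∧-true⁻ (lookup T b) q
... | b∈T , e = lookup⇒[]= a T a∈T , lookup⇒[]= b T b∈T , mkE e

induced-E⁺ : a ∈ T → b ∈ T → E H a b → E (induced H T) a b
induced-E⁺ {a = a} {b = b} a∈T b∈T (mkE e)
  = mkE (trans (lookup²∘tabulate² _ a b) (cong₂ _∧_ ([]=⇒lookup a∈T) (cong₂ _∧_ ([]=⇒lookup b∈T) e)))

induced-WellFormed : WellFormed (induced H T)
induced-WellFormed {H = H} e = let a∈T , b∈T , _ = induced-E⁻ {H = H} e in mkV a∈T , mkV b∈T

induced-≼ : T ⊆ verts H → induced H T ≼ H
induced-≼ {H = H} T⊆H = mk≼ (λ p → mkV (T⊆H (unV p))) (λ e → proj₂ (proj₂ (induced-E⁻ {H = H} e)))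

≼-induced : {C : SubDigraph n} → WellFormed C → C ≼ H → verts C ⊆ T → C ≼ induced H T
≼-induced {H = H} wf C≼H C⊆T = mk≼ (λ p → mkV (C⊆T (unV p)))
  (λ e → induced-E⁺ {H = H} (C⊆T (unV (proj₁ (wf e)))) (C⊆T (unV (proj₂ (wf e)))) (≼-E C≼H e))

point : Fin n → SubDigraph n
point {n} x = mkSub ⁅ x ⁆ (replicate n (replicate n false))

point-V : V (point x) x
point-V {x = x} = mkV (x∈⁅x⁆ x)

point-V⁻ : V (point x) y → y ≡ x
point-V⁻ {x = x} (mkV p) = x∈⁅y⁆⇒x≡y x p

point-E : ¬ E (point x) a b
point-E {a = a} {b = b} (mkE e)
  with trans (sym (trans (cong (λ r → lookup r b) (lookup-replicate a _)) (lookup-replicate b false))) e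
... | ()

point-WellFormed : WellFormed (point x)
point-WellFormed e = ⊥-elim (point-E e)

point-≼ : V H x → point x ≼ H
point-≼ {H = H} x∈H = mk≼ (λ p → subst (V H) (sym (point-V⁻ p)) x∈H) (λ e → ⊥-elim (point-E e))

Adjacent : SubDigraph n → Fin n → Fin n → Set
Adjacent H u w = E H u w ⊎ E H w u

Adjacent-sym : Adjacent H u w → Adjacent H w u
Adjacent-sym = Sum.swap

Adjacent-mono : H ≼ K → Adjacent H u w → Adjacent K u w
Adjacent-mono H≼K = Sum.map (≼-E H≼K) (≼-E H≼K)

Adjacent-end : WellFormed H → Adjacent H u w → V H w
Adjacent-end wf (inj₁ e) = proj₂ (wf e)
Adjacent-end wf (inj₂ e) = proj₁ (wf e)

data Walk (H : SubDigraph n) : Fin n → Fin n → Set where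
  stop : V H u → Walk H u u
  move : V H u → Adjacent H u w → Walk H w v → Walk H u v

Walk-start : Walk H u v → V H u
Walk-start (stop p)     = p
Walk-start (move p _ _) = p

Walk-end : Walk H u v → V H v
Walk-end (stop p)     = p
Walk-end (move _ _ q) = Walk-end q

_++ʷ_ : Walk H u v → Walk H v w → Walk H u w
stop _      ++ʷ q = q
move p e p′ ++ʷ q = move p e (p′ ++ʷ q)

reverseʷ : Walk H u v → Walk H v u
reverseʷ (stop p)     = stop p
reverseʷ (move p e q) = reverseʷ q ++ʷ move (Walk-start q) (Adjacent-sym e) (stop p)

Walk-mono : H ≼ K → Walk H u v → Walk K u v
Walk-mono H≼K (stop p)     = stop (≼-V H≼K p)
Walk-mono H≼K (move p e q) = move (≼-V H≼K p) (Adjacent-mono H≼K e) (Walk-mono H≼K q)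

WalkConnected : SubDigraph n → Set
WalkConnected H = ∀ {a b} → V H a → V H b → Walk H a b

hub⇒WalkConnected : (h : Fin n) → (∀ {y} → V H y → Walk H y h) → WalkConnected H
hub⇒WalkConnected _ toHub p q = toHub p ++ʷ reverseʷ (toHub q)

WalkConnected-transfer : H ≼ K → verts K ⊆ verts H → WalkConnected H → WalkConnected K
WalkConnected-transfer H≼K K⊆H conn p q = Walk-mono H≼K (conn (mkV (K⊆H (unV p))) (mkV (K⊆H (unV q))))

≤1-vertex⇒WalkConnected : (∀ {y z} → V H y → V H z → y ≡ z) → WalkConnected H
≤1-vertex⇒WalkConnected {H = H} ≤1 {b = b} p q = subst (λ z → Walk H z b) (≤1 q p) (stop q)

point-WalkConnected : WalkConnected (point x)
point-WalkConnected = ≤1-vertex⇒WalkConnected λ p q → trans (point-V⁻ p) (sym (point-V⁻ q))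

Walk-removeV : ¬ V H y → Walk H a b → Walk (removeV H y) a b
Walk-removeV y∉H (stop p)     = stop (removeV-V⁺ (λ { refl → y∉H p }) p)
Walk-removeV {H = H} y∉H (move p a~c q) =
  move (removeV-V⁺ (≢y p) p) (Sum.map (λ e → removeV-E⁺ (≢y p) (≢y (Walk-start q)) e)
                                      (λ e → removeV-E⁺ (≢y (Walk-start q)) (≢y p) e) a~c)
       (Walk-removeV y∉H q)
  where
  ≢y : V H x → x ≢ _
  ≢y x∈H refl = y∉H x∈H

chain⇒walk : ∀ {xs} → Chain H u v xs → Walk H u v
chain⇒walk (single p)   = stop (mkV p)
chain⇒walk (step p e c) = move (mkV p) (Sum.map mkE mkE e) (chain⇒walk c)

walk⇒chain : Walk H u v → ∃ (Chain H u v)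
walk⇒chain (stop p)     = _ , single (unV p)
walk⇒chain (move p e q) = _ , step (unV p) (Sum.map unE unE e) (proj₂ (walk⇒chain q))

Chain-suffix : ∀ {xs} → Chain H w v xs → Unique xs → u ∈ˡ xs → Path H u v
Chain-suffix (single p)     uq       (here refl) = _ , single p , uq
Chain-suffix c@(step _ _ _) uq       (here refl) = _ , c , uq
Chain-suffix (step _ _ c)   (_ ∷ uq) (there u∈)  = Chain-suffix c uq u∈

chain⇒path : ∀ {xs} → Chain H u v xs → Path H u v
chain⇒path (single p) = _ , single p , [] ∷ []
chain⇒path {u = u} (step p e c) with chain⇒path c
... | ys , c′ , uq with any? (u ≟_) ys
... | yes u∈ys = Chain-suffix c′ uq u∈ys
... | no  u∉ys = u ∷ ys , step p e c′ , ¬Any⇒All¬ ys u∉ys ∷ uq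

walk⇒path : Walk H u v → Path H u v
walk⇒path q = chain⇒path (proj₂ (walk⇒chain q))

Connected⇒WalkConnected : Connected H → WalkConnected H
Connected⇒WalkConnected conn {a} {b} p q with a ≟ b
... | yes refl = stop p
... | no a≢b   = chain⇒walk (proj₁ (proj₂ (conn a b (unV p) (unV q) a≢b)))

WalkConnected⇒Connected : WalkConnected H → Connected H
WalkConnected⇒Connected conn _ _ p q _ = walk⇒path (conn (mkV p) (mkV q))

Chain-head : ∀ {xs} → Chain H u v xs → u ∈ˡ xs
Chain-head (single _)   = here refl
Chain-head (step _ _ _) = here refl

Chain-last : ∀ {xs} → Chain H u v xs → v ∈ˡ xs
Chain-last (single _)   = here refl
Chain-last (step _ _ c) = there (Chain-last c)

Chain-V : ∀ {xs} → Chain H u v xs → x ∈ˡ xs → V H x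
Chain-V (single p)   (here refl) = mkV p
Chain-V (step p _ _) (here refl) = mkV p
Chain-V (step _ _ c) (there x∈)  = Chain-V c x∈

Chain-transfer : ∀ {xs} → Chain H u v xs → (∀ {x} → x ∈ˡ xs → V K x) →
                 (∀ {a b} → V K a → V K b → E H a b → E K a b) → Walk K u v
Chain-transfer (single _) ⊆K _ = stop (⊆K (here refl))
Chain-transfer (step _ u~w c) ⊆K E⊆K =
  move (⊆K (here refl)) (Sum.map (E⊆K u∈K w∈K ∘ mkE) (E⊆K w∈K u∈K ∘ mkE) u~w)
       (Chain-transfer c (⊆K ∘ there) E⊆K)
  where
  u∈K = ⊆K (here refl)
  w∈K = ⊆K (there (Chain-head c))

Chain-split : ∀ {xs} → Chain H u v xs → Unique xs → y ∈ˡ xs →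
  Σ (List (Fin n)) λ ps → Σ (List (Fin n)) λ qs → Chain H u y ps × Chain H y v qs ×
    (∀ {z} → z ∈ˡ ps → z ∈ˡ xs) × (∀ {z} → z ∈ˡ qs → z ∈ˡ xs) × (∀ {z} → z ∈ˡ ps → z ∈ˡ qs → z ≡ y)
Chain-split (single p) _ (here refl) =
  _ , _ , single p , single p , (λ z∈ → z∈) , (λ z∈ → z∈) , λ { (here refl) _ → refl }
Chain-split c@(step p _ _) _ (here refl) =
  _ , _ , single p , c , (λ { (here refl) → here refl }) , (λ z∈ → z∈) , λ { (here refl) _ → refl }
Chain-split (step p u~w c) (u∉ ∷ uq) (there y∈) with Chain-split c uq y∈
... | ps , qs , cp , cq , ps⊆ , qs⊆ , meet =
  _ ∷ ps , qs , step p u~w cp , cq ,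
  (λ { (here refl) → here refl ; (there z∈) → there (ps⊆ z∈) }) , there ∘ qs⊆ ,
  λ { (here refl) z∈qs → ⊥-elim (All.lookup u∉ (qs⊆ z∈qs) refl) ; (there z∈) z∈qs → meet z∈ z∈qs }

¬¬-WalkConnected : (∀ {a b} → V H a → V H b → ¬ ¬ Walk H a b) → ¬ ¬ WalkConnected H
¬¬-WalkConnected conn = do
  walks ← ¬¬-∀-Fin _ λ a → ¬¬-∀-Fin _ λ b → ¬¬-→ λ p → ¬¬-→ λ q → conn {a} {b} p q
  return λ {a} {b} → walks a b

-- Finiteness: maximal elements and enumerations

edgeCount : ∀ {m} → Vec (Subset n) m → ℕ
edgeCount []       = 0
edgeCount (r ∷ rs) = ∣ r ∣ + edgeCount rs

edgeCount-bound : ∀ {m} (F : Vec (Subset n) m) → edgeCount F ≤ m * n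
edgeCount-bound []       = z≤n
edgeCount-bound (r ∷ rs) = +-mono-≤ (∣p∣≤n r) (edgeCount-bound rs)

edgeCount-mono : ∀ {m} (F F′ : Vec (Subset n) m) → (∀ i → lookup F i ⊆ lookup F′ i) →
                 edgeCount F ≤ edgeCount F′
edgeCount-mono []      []        _    = z≤n
edgeCount-mono (r ∷ F) (r′ ∷ F′) F⊆F′ =
  +-mono-≤ (p⊆q⇒∣p∣≤∣q∣ (F⊆F′ zero)) (edgeCount-mono F F′ (λ i → F⊆F′ (suc i)))

edgeCount-strict : ∀ {m} (F F′ : Vec (Subset n) m) → (∀ i → lookup F i ⊆ lookup F′ i) → F ≢ F′ →
                   edgeCount F < edgeCount F′
edgeCount-strict []      []        _    F≢F′ = ⊥-elim (F≢F′ refl)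
edgeCount-strict (r ∷ F) (r′ ∷ F′) F⊆F′ F≢F′ with ≡-dec Bool._≟_ r r′
... | yes refl = +-mono-≤-< (p⊆q⇒∣p∣≤∣q∣ (F⊆F′ zero))
                             (edgeCount-strict F F′ (λ i → F⊆F′ (suc i)) λ { refl → F≢F′ refl })
... | no  r≢r′ = +-mono-<-≤ (p⊂q⇒∣p∣<∣q∣ (⊆∧≢⇒⊂ (F⊆F′ zero) r≢r′))
                             (edgeCount-mono F F′ (λ i → F⊆F′ (suc i)))

size : SubDigraph n → ℕ
size S = ∣ verts S ∣ + edgeCount (edges S)

size-bound : (S : SubDigraph n) → size S ≤ n + n * n
size-bound S = +-mono-≤ (∣p∣≤n (verts S)) (edgeCount-bound (edges S))

private
  ≼⇒rows⊆ : H ≼ K → ∀ a → lookup (edges H) a ⊆ lookup (edges K) a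
  ≼⇒rows⊆ H≼K a b∈ = lookup⇒[]= _ _ (unE (≼-E H≼K (mkE ([]=⇒lookup b∈))))

size-strict : H ≼ K → H ≢ K → size H < size K
size-strict {H = mkSub vs es} {K = mkSub vs′ es′} H≼K H≢K with ≡-dec Bool._≟_ vs vs′
... | yes refl = +-mono-≤-< (≤-refl {∣ vs ∣}) (edgeCount-strict es es′ (≼⇒rows⊆ H≼K) λ { refl → H≢K refl })
... | no  vs≢vs′ = +-mono-<-≤ (p⊂q⇒∣p∣<∣q∣ (⊆∧≢⇒⊂ (λ p → unV (≼-V H≼K (mkV p))) vs≢vs′))
                              (edgeCount-mono es es′ (≼⇒rows⊆ H≼K))

_≟ˢ_ : (S S′ : SubDigraph n) → Dec (S ≡ S′)
mkSub vs es ≟ˢ mkSub vs′ es′ with ≡-dec Bool._≟_ vs vs′ | ≡-dec (≡-dec Bool._≟_) es es′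
... | yes refl   | yes refl   = yes refl
... | no vs≢vs′  | _          = no λ { refl → vs≢vs′ refl }
... | yes _      | no es≢es′  = no λ { refl → es≢es′ refl }

IsMaximal : (SubDigraph n → Set) → SubDigraph n → Set
IsMaximal P M = ∀ M′ → P M′ → M ≼ M′ → M ≡ M′

¬¬-maximal-above : ∀ {n} (P : SubDigraph n → Set) {H} → P H →
                   ¬ ¬ Σ (SubDigraph n) λ M → P M × H ≼ M × IsMaximal P M
¬¬-maximal-above {n = n} P {H} pH = climb (suc bound) H pH (m≤n+m (suc bound) (size H))
  where
  bound = n + n * n
  StrictlyAbove : SubDigraph n → Set
  StrictlyAbove S = Σ (SubDigraph n) λ S′ → P S′ × S ≼ S′ × S ≢ S′
  -- The fuel suffices: size never exceeds bound and strictly increases at every step.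
  climb : ∀ fuel S → P S → bound < size S + fuel → ¬ ¬ Σ (SubDigraph n) λ M → P M × S ≼ M × IsMaximal P M
  climb zero S _ fuel-ok = ⊥-elim (<⇒≱ (<-≤-trans fuel-ok (≤-reflexive (+-identityʳ (size S)))) (size-bound S))
  climb (suc fuel) S pS fuel-ok = ¬¬-excluded-middle {A = StrictlyAbove S} >>= λ where
    (yes (S′ , pS′ , S≼S′ , S≢S′)) → do
      let fuel-ok′ = <-≤-trans fuel-ok (≤-trans (≤-reflexive (+-suc (size S) fuel))
                                                (+-monoˡ-≤ fuel (size-strict S≼S′ S≢S′)))
      M , pM , S′≼M , M-max ← climb fuel S′ pS′ fuel-ok′
      return (M , pM , ≼-trans S≼S′ S′≼M , M-max)
    (no none) → return (S , pS , ≼-refl , λ S′ pS′ S≼S′ →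
      decidable-stable (S ≟ˢ S′) λ S≢S′ → none (S′ , pS′ , S≼S′ , S≢S′))

allSubDigraphs : ∀ n → List (SubDigraph n)
allSubDigraphs n = cartesianProductWith mkSub rows (choices n λ _ → rows)
  where rows = choices n λ _ → true ∷ false ∷ []

∈-allSubDigraphs : ∀ {n} (S : SubDigraph n) → S ∈ˡ allSubDigraphs n
∈-allSubDigraphs {n} (mkSub vs es) =
  ∈-cartesianProductWith⁺ mkSub (∈-row vs) (∈-choices⁺ n es λ i → ∈-row (lookup es i))
  where
  ∈-bools : ∀ b → b ∈ˡ true ∷ false ∷ []
  ∈-bools true  = here refl
  ∈-bools false = there (here refl)
  ∈-row : (r : Subset n) → r ∈ˡ choices n λ _ → true ∷ false ∷ []
  ∈-row r = ∈-choices⁺ n r λ i → ∈-bools (lookup r i)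

Enumerates : (SubDigraph n → Set) → List (SubDigraph n) → Set
Enumerates P L = Unique L × All P L × (∀ S → P S → S ∈ˡ L)

¬¬-enumeration : ∀ {n} (P : SubDigraph n → Set) → ¬ ¬ Σ (List (SubDigraph n)) (Enumerates P)
¬¬-enumeration {n = n} P = do
  ys , all , complete ← ¬¬-filter P (allSubDigraphs n)
  return (deduplicate _≟ˢ_ ys ,
          UniqueDec.deduplicate-! _≟ˢ_ ys ,
          All.tabulate (λ y∈ → All.lookup all (∈-deduplicate⁻ _≟ˢ_ ys y∈)) ,
          λ S pS → ∈-deduplicate⁺ _≟ˢ_ (complete (∈-allSubDigraphs S) pS))

-- Components

induced-Adjacent : a ∈ T → b ∈ T → Adjacent H a b → Adjacent (induced H T) a b
induced-Adjacent {H = H} a∈T b∈T (inj₁ e) = inj₁ (induced-E⁺ {H = H} a∈T b∈T e)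
induced-Adjacent {H = H} a∈T b∈T (inj₂ e) = inj₂ (induced-E⁺ {H = H} b∈T a∈T e)

record Component (H C : SubDigraph n) : Set where
  constructor mkComponent
  field isComponent : IsComponent H C
open Component public

module _ {H C : SubDigraph n} (comp : Component H C) where
  private
    sub = proj₁ (isComponent comp)

  Component-≼ : C ≼ H
  Component-≼ = IsSubOf⇒≼ {K = H} sub

  Component-WellFormed : WellFormed C
  Component-WellFormed = IsSubOf⇒WellFormed {K = H} sub

  Component-WalkConnected : WalkConnected C
  Component-WalkConnected = Connected⇒WalkConnected (proj₁ (proj₂ (isComponent comp)))

  Component-≼-induced : verts C ⊆ T → C ≼ induced H T
  Component-≼-induced = ≼-induced {H = H} Component-WellFormed Component-≼

  Component-grow : verts C ⊆ T → T ⊆ verts H → WalkConnected (induced H T) → C ≡ induced H T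
  Component-grow {T = T} C⊆T T⊆H conn = proj₂ (proj₂ (isComponent comp)) (induced H T)
    (≼⇒IsSubOf {K = H} (induced-WellFormed {H = H}) (induced-≼ T⊆H)) (WalkConnected⇒Connected conn)
    (≼⇒⊑ (Component-≼-induced C⊆T))

  Component-induced : V C a → V C b → E H a b → E C a b
  Component-induced {a = a} {b = b} a∈C b∈C e =
    subst (λ D → E D a b) (sym C≡C̃) (induced-E⁺ {H = H} (unV a∈C) (unV b∈C) e)
    where
    C≡C̃ : C ≡ induced H (verts C)
    C≡C̃ = Component-grow (λ p → p) (λ p → unV (≼-V Component-≼ (mkV p)))
      (WalkConnected-transfer (Component-≼-induced (λ p → p)) (λ p → p) Component-WalkConnected)

  Component-adjacent : WellFormed H → V C a → Adjacent H a b → V C b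
  Component-adjacent {a = a} {b = b} wf a∈C a~b = subst (λ D → V D b) (sym C≡C⁺) (mkV b∈C+b)
    where
    C+b = verts C ∪ ⁅ b ⁆
    C⁺ = induced H C+b
    C⊆C+b : verts C ⊆ C+b
    C⊆C+b p = x∈p∪q⁺ (inj₁ p)
    b∈C+b : b ∈ C+b
    b∈C+b = x∈p∪q⁺ (inj₂ (x∈⁅x⁆ b))
    C+b⊆H : C+b ⊆ verts H
    C+b⊆H p with x∈p∪q⁻ (verts C) ⁅ b ⁆ p
    ... | inj₁ x∈C = unV (≼-V Component-≼ (mkV x∈C))
    ... | inj₂ x∈b rewrite x∈⁅y⁆⇒x≡y b x∈b = unV (Adjacent-end wf a~b)
    toA : ∀ {y} → V C⁺ y → Walk C⁺ y a
    toA (mkV y∈C+b) with x∈p∪q⁻ (verts C) ⁅ b ⁆ y∈C+b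
    ... | inj₁ y∈C = Walk-mono (Component-≼-induced C⊆C+b) (Component-WalkConnected (mkV y∈C) a∈C)
    ... | inj₂ y∈b rewrite x∈⁅y⁆⇒x≡y b y∈b =
      move (mkV b∈C+b) (induced-Adjacent {H = H} b∈C+b (C⊆C+b (unV a∈C)) (Adjacent-sym a~b))
           (stop (mkV (C⊆C+b (unV a∈C))))
    C≡C⁺ : C ≡ C⁺
    C≡C⁺ = Component-grow C⊆C+b C+b⊆H (hub⇒WalkConnected a toA)

  Component-closed : WellFormed H → V C a → Walk H a b → V C b
  Component-closed wf a∈C (stop _)       = a∈C
  Component-closed wf a∈C (move _ a~w q) = Component-closed wf (Component-adjacent wf a∈C a~w) q

Component-≼-Component : {C D : SubDigraph n} → WellFormed H → Component H C → Component H D →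
                        V C x → V D x → C ≼ D
Component-≼-Component wf compC compD x∈C x∈D = mk≼ C⊆D
  (λ e → Component-induced compD (C⊆D (proj₁ (Component-WellFormed compC e)))
                                 (C⊆D (proj₂ (Component-WellFormed compC e))) (≼-E (Component-≼ compC) e))
  where
  C⊆D : ∀ {y} → V _ y → V _ y
  C⊆D y∈C = Component-closed compD wf x∈D (Walk-mono (Component-≼ compC) (Component-WalkConnected compC x∈C y∈C))

Component-unique : {C D : SubDigraph n} → WellFormed H → Component H C → Component H D →
                   V C x → V D x → C ≡ D
Component-unique wf compC compD x∈C x∈D =
  ≼-antisym (Component-≼-Component wf compC compD x∈C x∈D) (Component-≼-Component wf compD compC x∈D x∈C)

Component-removeV : {C : SubDigraph n} → Component H C → ¬ V C x → Component (removeV H x) C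
Component-removeV {H = H} {x = x} {C = C} comp x∉C =
  mkComponent (≼⇒IsSubOf {K = removeV H x} (Component-WellFormed comp) C≼H-x , proj₁ (proj₂ (isComponent comp)) ,
               λ C′ sub conn C⊑C′ → proj₂ (proj₂ (isComponent comp)) C′
                 (≼⇒IsSubOf {K = H} (IsSubOf⇒WellFormed {H = C′} {K = removeV H x} sub)
                                    (≼-trans (IsSubOf⇒≼ {H = C′} {K = removeV H x} sub) removeV-≼)) conn C⊑C′)
  where
  ≢x : V C y → y ≢ x
  ≢x y∈C refl = x∉C y∈C
  C≼H-x : C ≼ removeV H x
  C≼H-x = mk≼ (λ y∈C → removeV-V⁺ (≢x y∈C) (≼-V (Component-≼ comp) y∈C))
    (λ e → removeV-E⁺ (≢x (proj₁ (Component-WellFormed comp e))) (≢x (proj₂ (Component-WellFormed comp e)))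
                      (≼-E (Component-≼ comp) e))

Component-self : WellFormed H → WalkConnected H → Component H H
Component-self {H = H} wf conn = mkComponent (≼⇒IsSubOf {K = H} wf ≼-refl , WalkConnected⇒Connected conn ,
  λ C′ sub _ H⊑C′ → ≼-antisym (⊑⇒≼ H⊑C′) (IsSubOf⇒≼ {H = C′} {K = H} sub))

¬¬-Component-at : WellFormed H → V H x → ¬ ¬ Σ (SubDigraph n) λ C → Component H C × V C x
¬¬-Component-at {H = H} {x = x} wf x∈H = do
  M , (sub , conn) , x≼M , max ← ¬¬-maximal-above (λ C → IsSubOf C H × Connected C) start
  return (M , mkComponent (sub , conn , λ C′ sub′ conn′ M⊑C′ → max C′ (sub′ , conn′) (⊑⇒≼ M⊑C′)) , ≼-V x≼M point-V)
  where
  start : IsSubOf (point x) H × Connected (point x)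
  start = ≼⇒IsSubOf {K = H} point-WellFormed (point-≼ x∈H) , WalkConnected⇒Connected point-WalkConnected

-- Cut-vertices

module Separation {H : SubDigraph n} (wf : WellFormed H)
                  (q : Walk H u w) (¬q : ¬ Walk (removeV H x) u w) where

  Component-avoids-u : {C : SubDigraph n} → Component H C → ¬ V C x → ¬ V C u
  Component-avoids-u comp x∉C u∈C = ¬q (Walk-mono (Component-≼ (Component-removeV comp x∉C))
    (Component-WalkConnected comp u∈C (Component-closed comp wf u∈C q)))

  Component-avoids-w : {C : SubDigraph n} → Component H C → ¬ V C x → ¬ V C w
  Component-avoids-w comp x∉C w∈C =
    Component-avoids-u comp x∉C (Component-closed comp wf w∈C (reverseʷ q))

  -- The components of H that avoid x survive in H - x, and the one containing x splits into at least two.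
  more-components : ∀ {L L′ Cx Du Dw} →
    Enumerates (IsComponent H) L → Enumerates (IsComponent (removeV H x)) L′ →
    Component H Cx → V Cx x →
    Component (removeV H x) Du → V Du u → Component (removeV H x) Dw → V Dw w →
    length L < length L′
  more-components {L} {L′} {Cx} {Du} {Dw} (uqL , allL , _) (_ , _ , completeL′) compCx x∈Cx compDu u∈Du compDw w∈Dw =
    ≤-trans (s≤s L≤Cx∷Lx) (Unique-⊆⇒length-≤ uq-new new⊆L′)
    where
    avoids-x = λ C → ¬? (V? C x)
    Lx = filter avoids-x L

    ∈Lx⇒avoiding : ∀ {C} → C ∈ˡ Lx → Component H C × ¬ V C x
    ∈Lx⇒avoiding C∈ = let C∈L , x∉C = ∈-filter⁻ avoids-x C∈ in mkComponent (All.lookup allL C∈L) , x∉C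

    L≤Cx∷Lx : length L ≤ length (Cx ∷ Lx)
    L≤Cx∷Lx = Unique-⊆⇒length-≤ uqL λ {C} C∈L → case-x C∈L (V? C x)
      where
      case-x : ∀ {C} → C ∈ˡ L → Dec (V C x) → C ∈ˡ Cx ∷ Lx
      case-x C∈L (yes x∈C) = here (Component-unique wf (mkComponent (All.lookup allL C∈L)) compCx x∈C x∈Cx)
      case-x C∈L (no x∉C)  = there (∈-filter⁺ avoids-x C∈L x∉C)

    Du∉Lx : Du ∉ˡ Lx
    Du∉Lx Du∈ = let comp , x∉Du = ∈Lx⇒avoiding Du∈ in Component-avoids-u comp x∉Du u∈Du

    Dw∉Lx : Dw ∉ˡ Lx
    Dw∉Lx Dw∈ = let comp , x∉Dw = ∈Lx⇒avoiding Dw∈ in Component-avoids-w comp x∉Dw w∈Dw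

    Du≢Dw : Du ≢ Dw
    Du≢Dw refl = ¬q (Walk-mono (Component-≼ compDu) (Component-WalkConnected compDu u∈Du w∈Dw))

    uq-new : Unique (Du ∷ Dw ∷ Lx)
    uq-new = (Du≢Dw ∷ All.tabulate (λ C∈ Du≡C → Du∉Lx (subst (_∈ˡ Lx) (sym Du≡C) C∈)))
           ∷ All.tabulate (λ C∈ Dw≡C → Dw∉Lx (subst (_∈ˡ Lx) (sym Dw≡C) C∈))
           ∷ filter⁺ avoids-x uqL

    new⊆L′ : ∀ {C} → C ∈ˡ Du ∷ Dw ∷ Lx → C ∈ˡ L′
    new⊆L′ (here refl)         = completeL′ _ (isComponent compDu)
    new⊆L′ (there (here refl)) = completeL′ _ (isComponent compDw)
    new⊆L′ (there (there C∈))  = let comp , x∉C = ∈Lx⇒avoiding C∈ in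
                                 completeL′ _ (isComponent (Component-removeV comp x∉C))

¬¬-separating⇒cut : {H : SubDigraph n} → WellFormed H → V H x → u ≢ x → w ≢ x →
                    Walk H u w → ¬ Walk (removeV H x) u w → ¬ ¬ IsCutVertex H x
¬¬-separating⇒cut {x = x} {H = H} wf x∈H u≢x w≢x q ¬q = do
  L  , enumL@(uqL , allL , completeL)      ← ¬¬-enumeration (IsComponent H)
  L′ , enumL′@(uqL′ , allL′ , completeL′)  ← ¬¬-enumeration (IsComponent (removeV H x))
  Cx , compCx , x∈Cx ← ¬¬-Component-at wf x∈H
  Du , compDu , u∈Du ← ¬¬-Component-at (removeV-WellFormed wf) (removeV-V⁺ u≢x (Walk-start q))
  Dw , compDw , w∈Dw ← ¬¬-Component-at (removeV-WellFormed wf) (removeV-V⁺ w≢x (Walk-end q))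
  return (unV x∈H , length L , length L′ ,
          (L , uqL , allL , completeL , refl) , (L′ , uqL′ , allL′ , completeL′ , refl) ,
          Separation.more-components wf q ¬q enumL enumL′ compCx x∈Cx compDu u∈Du compDw w∈Dw)

StaysConnected : SubDigraph n → Set
StaysConnected H = ∀ y → WalkConnected (removeV H y)

StaysConnected⇒NoCutVertex : WellFormed H → WalkConnected H → StaysConnected H → NoCutVertex H
StaysConnected⇒NoCutVertex {H = H} wf conn stays y (_ , _ , _ , (L , _ , _ , completeL , refl) ,
                                                      (L′ , uqL′ , allL′ , _ , refl) , L<L′) =
  <⇒≱ L<L′ (≤-trans L′≤1 (∈⇒length-≥1 (completeL H (isComponent (Component-self wf conn)))))
  where
  C≡H-y : ∀ {C} → C ∈ˡ L′ → C ≡ removeV H y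
  C≡H-y {C} C∈ = let sub , _ , max = All.lookup allL′ C∈ in
    max (removeV H y) (≼⇒IsSubOf {K = removeV H y} (removeV-WellFormed wf) ≼-refl)
        (WalkConnected⇒Connected (stays y)) (≼⇒⊑ (IsSubOf⇒≼ {H = C} {K = removeV H y} sub))
  L′≤1 : length L′ ≤ 1
  L′≤1 = length-≤1 uqL′ λ C∈ D∈ → trans (C≡H-y C∈) (sym (C≡H-y D∈))

StaysConnected-transfer : H ≼ K → verts K ⊆ verts H → StaysConnected H → StaysConnected K
StaysConnected-transfer {H = H} {K = K} H≼K K⊆H stays y = WalkConnected-transfer (removeV-mono H≼K) K-y⊆H-y (stays y)
  where
  K-y⊆H-y : verts (removeV K y) ⊆ verts (removeV H y)
  K-y⊆H-y x∈ = let x≢y , x∈K = removeV-V⁻ {H = K} (mkV x∈) in unV (removeV-V⁺ {H = H} x≢y (mkV (K⊆H (unV x∈K))))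

-- Blocks

module Blocks {n : ℕ} (G : Digraph n) where

  private variable
    B B₁ B₂ : SubDigraph n

  Block-≼ : IsBlock G B → B ≼ whole G
  Block-≼ {B = B} (sub , _) = IsSubOf⇒≼ {H = B} {K = whole G} sub

  Block-WellFormed : IsBlock G B → WellFormed B
  Block-WellFormed {B = B} (sub , _) = IsSubOf⇒WellFormed {H = B} {K = whole G} sub

  Block-WalkConnected : IsBlock G B → WalkConnected B
  Block-WalkConnected (_ , conn , _) = Connected⇒WalkConnected conn

  ¬¬-Block-StaysConnected : IsBlock G B → ¬ ¬ StaysConnected B
  ¬¬-Block-StaysConnected {B = B} blk@(_ , _ , noCut , _) = ¬¬-∀-Fin n λ y → connected-without y (V? B y)
    where
    connected-without : ∀ y → Dec (V B y) → ¬ ¬ WalkConnected (removeV B y)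
    connected-without y (no y∉B) = return λ {_} {_} p q →
      Walk-removeV y∉B (Block-WalkConnected blk (proj₂ (removeV-V⁻ {H = B} p)) (proj₂ (removeV-V⁻ {H = B} q)))
    -- A vertex y of B separating two others would be a cut-vertex of B.
    connected-without y (yes y∈B) = ¬¬-WalkConnected λ {a} {b} p q → ¬¬-excluded-middle >>= λ where
      (yes walk) → return walk
      (no ¬walk) → λ _ →
        let a≢y , a∈B = removeV-V⁻ {H = B} p
            b≢y , b∈B = removeV-V⁻ {H = B} q
        in ¬¬-separating⇒cut (Block-WellFormed blk) y∈B a≢y b≢y (Block-WalkConnected blk a∈B b∈B) ¬walk (noCut y)

  Block-grow : IsBlock G B → verts B ⊆ T →
               WalkConnected (induced (whole G) T) → StaysConnected (induced (whole G) T) →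
               B ≡ induced (whole G) T
  Block-grow {T = T} blk@(_ , _ , _ , max) B⊆T conn stays = max (induced (whole G) T)
    (≼⇒IsSubOf {K = whole G} (induced-WellFormed {H = whole G}) (induced-≼ λ _ → ∈⊤))
    (WalkConnected⇒Connected conn) (StaysConnected⇒NoCutVertex (induced-WellFormed {H = whole G}) conn stays)
    (≼⇒⊑ (≼-induced {H = whole G} (Block-WellFormed blk) (Block-≼ blk) B⊆T))

  Block-≡-induced : IsBlock G B → StaysConnected B → B ≡ induced (whole G) (verts B)
  Block-≡-induced blk stays = Block-grow blk (λ p → p)
    (WalkConnected-transfer B≼B̃ (λ p → p) (Block-WalkConnected blk)) (StaysConnected-transfer B≼B̃ (λ p → p) stays)
    where
    B≼B̃ = ≼-induced {H = whole G} (Block-WellFormed blk) (Block-≼ blk) (λ p → p)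

  Block-absorb : IsBlock G B₁ → IsBlock G B₂ → StaysConnected B₂ → verts B₁ ⊆ verts B₂ → B₁ ≡ B₂
  Block-absorb {B₂ = B₂} blk₁ blk₂ stays₂ B₁⊆B₂ =
    trans (Block-grow blk₁ B₁⊆B₂ (subst WalkConnected B₂≡B̃₂ (Block-WalkConnected blk₂))
                                 (subst StaysConnected B₂≡B̃₂ stays₂))
          (sym B₂≡B̃₂)
    where
    B₂≡B̃₂ = Block-≡-induced blk₂ stays₂

  ¬¬-Block-at : ∀ v → ¬ ¬ Σ (SubDigraph n) λ B → IsBlock G B × V B v
  ¬¬-Block-at v = do
    M , (sub , conn , noCut) , v≼M , max ← ¬¬-maximal-above Candidate start
    return (M , (sub , conn , noCut , λ B′ sub′ conn′ noCut′ M⊑B′ → max B′ (sub′ , conn′ , noCut′) (⊑⇒≼ M⊑B′)) ,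
            ≼-V v≼M point-V)
    where
    Candidate : SubDigraph n → Set
    Candidate C = IsSubOf C (whole G) × Connected C × NoCutVertex C
    start : Candidate (point v)
    start = ≼⇒IsSubOf {K = whole G} point-WellFormed (point-≼ V-whole) , WalkConnected⇒Connected point-WalkConnected ,
            StaysConnected⇒NoCutVertex point-WellFormed point-WalkConnected λ y →
              ≤1-vertex⇒WalkConnected λ p q → trans (point-V⁻ (proj₂ (removeV-V⁻ {H = point v} p)))
                                                     (sym (point-V⁻ (proj₂ (removeV-V⁻ {H = point v} q))))

  Block-IsInducedSubOf : IsBlock G B → IsInducedSubOf B (whole G)
  Block-IsInducedSubOf {B = B} blk = ≼⇒IsSubOf {K = whole G} (Block-WellFormed blk) (Block-≼ blk) ,
    λ a b a∈ b∈ e → unE (decidable-stable (E? B a b) do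
      stays ← ¬¬-Block-StaysConnected blk
      return (subst (λ D → E D a b) (sym (Block-≡-induced blk stays)) (induced-E⁺ {H = whole G} a∈ b∈ (mkE e))))

  -- Two blocks through v, joined by a path avoiding v, together with that path induce a subdigraph
  -- that stays connected after deleting any vertex; by maximality both blocks equal it.
  module Merge {B₁ B₂ : SubDigraph n} {v a b : Fin n}
               (blk₁ : IsBlock G B₁) (blk₂ : IsBlock G B₂)
               (stays₁ : StaysConnected B₁) (stays₂ : StaysConnected B₂)
               (v∈B₁ : V B₁ v) (v∈B₂ : V B₂ v) (a∈B₁ : V B₁ a) (b∈B₂ : V B₂ b) (a≢v : a ≢ v) (b≢v : b ≢ v)
               (walk : Walk (removeV (whole G) v) a b) where

    private
      path : Path (removeV (whole G) v) a b
      path = walk⇒path walk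
      xs = proj₁ path
      chain = proj₁ (proj₂ path)
      xs-unique = proj₂ (proj₂ path)

      U : Subset n
      U = verts B₁ ∪ (verts B₂ ∪ toSubset xs)

      merged : SubDigraph n
      merged = induced (whole G) U

      U-cases : y ∈ U → V B₁ y ⊎ V B₂ y ⊎ y ∈ˡ xs
      U-cases y∈U with x∈p∪q⁻ (verts B₁) _ y∈U
      ... | inj₁ y∈B₁ = inj₁ (mkV y∈B₁)
      ... | inj₂ y∈ with x∈p∪q⁻ (verts B₂) _ y∈
      ... | inj₁ y∈B₂ = inj₂ (inj₁ (mkV y∈B₂))
      ... | inj₂ y∈xs = inj₂ (inj₂ (∈-toSubset⁻ xs y∈xs))

      B₁⊆U : verts B₁ ⊆ U
      B₁⊆U p = x∈p∪q⁺ (inj₁ p)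

      B₂⊆U : verts B₂ ⊆ U
      B₂⊆U p = x∈p∪q⁺ (inj₂ (x∈p∪q⁺ (inj₁ p)))

      xs⊆U : y ∈ˡ xs → y ∈ U
      xs⊆U y∈ = x∈p∪q⁺ (inj₂ (x∈p∪q⁺ (inj₂ (∈-toSubset⁺ y∈))))

      B₁≼merged : B₁ ≼ merged
      B₁≼merged = ≼-induced {H = whole G} (Block-WellFormed blk₁) (Block-≼ blk₁) B₁⊆U

      B₂≼merged : B₂ ≼ merged
      B₂≼merged = ≼-induced {H = whole G} (Block-WellFormed blk₂) (Block-≼ blk₂) B₂⊆U

      v∉xs : v ∉ˡ xs
      v∉xs v∈ = proj₁ (removeV-V⁻ {H = whole G} (Chain-V chain v∈)) refl

      along : ∀ {p q ys} x → Chain (removeV (whole G) v) p q ys → (∀ {z} → z ∈ˡ ys → z ∈ˡ xs) → x ∉ˡ ys →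
              Walk (removeV merged x) p q
      along x c ys⊆xs x∉ys = Chain-transfer c
        (λ z∈ → removeV-V⁺ {H = merged} (λ { refl → x∉ys z∈ }) (mkV (xs⊆U (ys⊆xs z∈))))
        (λ p q e → let p≢x , p∈ = removeV-V⁻ {H = merged} p
                       q≢x , q∈ = removeV-V⁻ {H = merged} q
                   in removeV-E⁺ p≢x q≢x (induced-E⁺ {H = whole G} (unV p∈) (unV q∈) (≼-E removeV-≼ e)))

      in-B₁ : V B₁ y → V B₁ z → y ≢ x → z ≢ x → Walk (removeV merged x) y z
      in-B₁ p q y≢x z≢x = Walk-mono (removeV-mono B₁≼merged) (stays₁ _ (removeV-V⁺ y≢x p) (removeV-V⁺ z≢x q))

      in-B₂ : V B₂ y → V B₂ z → y ≢ x → z ≢ x → Walk (removeV merged x) y z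
      in-B₂ p q y≢x z≢x = Walk-mono (removeV-mono B₂≼merged) (stays₂ _ (removeV-V⁺ y≢x p) (removeV-V⁺ z≢x q))

      merged-WalkConnected : WalkConnected merged
      merged-WalkConnected = hub⇒WalkConnected v toV
        where
        toV : V merged y → Walk merged y v
        toV (mkV y∈U) with U-cases y∈U
        ... | inj₁ y∈B₁        = Walk-mono B₁≼merged (Block-WalkConnected blk₁ y∈B₁ v∈B₁)
        ... | inj₂ (inj₁ y∈B₂) = Walk-mono B₂≼merged (Block-WalkConnected blk₂ y∈B₂ v∈B₂)
        ... | inj₂ (inj₂ y∈xs) with Chain-split chain xs-unique y∈xs
        ... | _ , _ , cp , _ , ps⊆ , _ , _ =
          reverseʷ (Walk-mono removeV-≼ (along v cp ps⊆ (v∉xs ∘ ps⊆))) ++ʷ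
          Walk-mono B₁≼merged (Block-WalkConnected blk₁ a∈B₁ v∈B₁)

      merged-without-v : WalkConnected (removeV merged v)
      merged-without-v = hub⇒WalkConnected a toA
        where
        toA : V (removeV merged v) y → Walk (removeV merged v) y a
        toA p with removeV-V⁻ {H = merged} p
        ... | y≢v , mkV y∈U with U-cases y∈U
        ... | inj₁ y∈B₁        = in-B₁ y∈B₁ a∈B₁ y≢v a≢v
        ... | inj₂ (inj₁ y∈B₂) = in-B₂ y∈B₂ b∈B₂ y≢v b≢v ++ʷ reverseʷ (along v chain (λ z∈ → z∈) v∉xs)
        ... | inj₂ (inj₂ y∈xs) with Chain-split chain xs-unique y∈xs
        ... | _ , _ , cp , _ , ps⊆ , _ , _ = reverseʷ (along v cp ps⊆ (v∉xs ∘ ps⊆))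

      merged-without : x ≢ v → WalkConnected (removeV merged x)
      merged-without {x = x} x≢v = hub⇒WalkConnected v toV
        where
        v≢x : v ≢ x
        v≢x = x≢v ∘ sym
        toV : V (removeV merged x) y → Walk (removeV merged x) y v
        toV p with removeV-V⁻ {H = merged} p
        ... | y≢x , mkV y∈U with U-cases y∈U
        ... | inj₁ y∈B₁        = in-B₁ y∈B₁ v∈B₁ y≢x v≢x
        ... | inj₂ (inj₁ y∈B₂) = in-B₂ y∈B₂ v∈B₂ y≢x v≢x
        ... | inj₂ (inj₂ y∈xs) with Chain-split chain xs-unique y∈xs
        ... | ps , qs , cp , cq , ps⊆ , qs⊆ , meet with any? (x ≟_) ps
        ...   | no x∉ps  = reverseʷ (along x cp ps⊆ x∉ps) ++ʷ in-B₁ a∈B₁ v∈B₁ (λ { refl → x∉ps (Chain-head cp) }) v≢x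
        ...   | yes x∈ps = along x cq qs⊆ x∉qs ++ʷ in-B₂ b∈B₂ v∈B₂ (λ { refl → x∉qs (Chain-last cq) }) v≢x
          where
          x∉qs : x ∉ˡ qs
          x∉qs x∈qs = y≢x (sym (meet x∈ps x∈qs))

      merged-StaysConnected : StaysConnected merged
      merged-StaysConnected x with x ≟ v
      ... | yes refl = merged-without-v
      ... | no  x≢v  = merged-without x≢v

    B₁≡B₂ : B₁ ≡ B₂
    B₁≡B₂ = trans (Block-grow blk₁ B₁⊆U merged-WalkConnected merged-StaysConnected)
              (sym (Block-grow blk₂ B₂⊆U merged-WalkConnected merged-StaysConnected))

  ¬¬-shared⇒cut : IsBlock G B₁ → IsBlock G B₂ → B₁ ≢ B₂ → V B₁ v → V B₂ v → ¬ ¬ IsCutVertex (whole G) v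
  ¬¬-shared⇒cut {B₁ = B₁} {B₂ = B₂} {v = v} blk₁ blk₂ B₁≢B₂ v∈B₁ v∈B₂ = do
    stays₁ ← ¬¬-Block-StaysConnected blk₁
    stays₂ ← ¬¬-Block-StaysConnected blk₂
    cases stays₁ stays₂ (other B₁) (other B₂)
    where
    Other : SubDigraph n → Set
    Other B = ∃ λ y → V B y × y ≢ v

    other : ∀ B → Dec (Other B)
    other B = anyFin? λ y → V? B y ×-dec ¬? (y ≟ v)

    only-v : ∀ {B B′} → ¬ Other B → V B′ v → verts B ⊆ verts B′
    only-v {B} none v∈B′ {y} y∈B with y ≟ v
    ... | yes refl = unV v∈B′
    ... | no  y≢v  = ⊥-elim (none (y , mkV y∈B , y≢v))

    through-v : V B₁ a → V B₂ b → Walk (whole G) a b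
    through-v a∈B₁ b∈B₂ = Walk-mono (Block-≼ blk₁) (Block-WalkConnected blk₁ a∈B₁ v∈B₁) ++ʷ
                          Walk-mono (Block-≼ blk₂) (Block-WalkConnected blk₂ v∈B₂ b∈B₂)

    cases : StaysConnected B₁ → StaysConnected B₂ → Dec (Other B₁) → Dec (Other B₂) → ¬ ¬ IsCutVertex (whole G) v
    cases _ stays₂ (no none₁) _ = ⊥-elim (B₁≢B₂ (Block-absorb blk₁ blk₂ stays₂ (only-v none₁ v∈B₂)))
    cases stays₁ _ _ (no none₂) = ⊥-elim (B₁≢B₂ (sym (Block-absorb blk₂ blk₁ stays₁ (only-v none₂ v∈B₁))))
    cases stays₁ stays₂ (yes (a , a∈B₁ , a≢v)) (yes (b , b∈B₂ , b≢v)) = ¬¬-excluded-middle >>= λ where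
      (yes walk) → ⊥-elim (B₁≢B₂ (Merge.B₁≡B₂ blk₁ blk₂ stays₁ stays₂ v∈B₁ v∈B₂ a∈B₁ b∈B₂ a≢v b≢v walk))
      (no ¬walk) → ¬¬-separating⇒cut whole-WellFormed V-whole a≢v b≢v (through-v a∈B₁ b∈B₂) ¬walk

-- B-partitions as choices of a block for every vertex

blocksAt : ∀ {k} → Vec (SubDigraph n) k → Fin n → List (Fin k)
blocksAt []       v = []
blocksAt (B ∷ Bs) v with v ∈? verts B
... | yes _ = zero ∷ List.map suc (blocksAt Bs v)
... | no  _ = List.map suc (blocksAt Bs v)

length-blocksAt : ∀ {k} (Bs : Vec (SubDigraph n) k) v → length (blocksAt Bs v) ≡ cutIndex Bs v
length-blocksAt []       v = refl
length-blocksAt (B ∷ Bs) v with v ∈? verts B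
... | yes _ = cong suc (trans (length-map suc (blocksAt Bs v)) (length-blocksAt Bs v))
... | no  _ = trans (length-map suc (blocksAt Bs v)) (length-blocksAt Bs v)

∈-blocksAt⁻ : ∀ {k} (Bs : Vec (SubDigraph n) k) {v i} → i ∈ˡ blocksAt Bs v → v ∈ verts (lookup Bs i)
∈-blocksAt⁻ (B ∷ Bs) {v} i∈ with v ∈? verts B
∈-blocksAt⁻ (B ∷ Bs) (here refl) | yes v∈B = v∈B
∈-blocksAt⁻ (B ∷ Bs) (there i∈)  | yes _ with ∈-map⁻ suc i∈
... | _ , j∈ , refl = ∈-blocksAt⁻ Bs j∈
∈-blocksAt⁻ (B ∷ Bs) i∈          | no _ with ∈-map⁻ suc i∈
... | _ , j∈ , refl = ∈-blocksAt⁻ Bs j∈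

∈-blocksAt⁺ : ∀ {k} (Bs : Vec (SubDigraph n) k) {v} i → v ∈ verts (lookup Bs i) → i ∈ˡ blocksAt Bs v
∈-blocksAt⁺ (B ∷ Bs) {v} i v∈ with v ∈? verts B
∈-blocksAt⁺ (B ∷ Bs) zero    v∈ | yes _   = here refl
∈-blocksAt⁺ (B ∷ Bs) (suc i) v∈ | yes _   = there (∈-map⁺ suc (∈-blocksAt⁺ Bs i v∈))
∈-blocksAt⁺ (B ∷ Bs) zero    v∈ | no  v∉B = ⊥-elim (v∉B v∈)
∈-blocksAt⁺ (B ∷ Bs) (suc i) v∈ | no  _   = ∈-map⁺ suc (∈-blocksAt⁺ Bs i v∈)

blocksAt-unique : ∀ {k} (Bs : Vec (SubDigraph n) k) v → Unique (blocksAt Bs v)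
blocksAt-unique []       v = []
blocksAt-unique (B ∷ Bs) v with v ∈? verts B
... | yes _ = All.tabulate zero∉ ∷ Unique.map⁺ suc-injective (blocksAt-unique Bs v)
  where
  zero∉ : ∀ {i} → i ∈ˡ List.map suc (blocksAt Bs v) → zero ≢ i
  zero∉ i∈ refl with ∈-map⁻ suc i∈
  ... | _ , _ , ()
... | no  _ = Unique.map⁺ suc-injective (blocksAt-unique Bs v)

module Partitions {n k} (G : Digraph n) (Bs : Vec (SubDigraph n) k)
                  (Bs-induced : ∀ i → IsInducedSubOf (lookup Bs i) (whole G)) where

  Valid : Vec (Fin k) n → Set
  Valid f = ∀ v → v ∈ verts (lookup Bs (lookup f v))

  class : Vec (Fin k) n → Fin k → Subset n
  class f i = tabulate λ v → does (lookup f v ≟ i)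

  ∈-class⁺ : ∀ f {i v} → lookup f v ≡ i → v ∈ class f i
  ∈-class⁺ f {i} {v} fv≡i = lookup⇒[]= v _ (trans (lookup∘tabulate _ v) (dec-true (lookup f v ≟ i) fv≡i))

  ∈-class⁻ : ∀ f {i v} → v ∈ class f i → lookup f v ≡ i
  ∈-class⁻ f {i} {v} v∈ with lookup f v ≟ i | trans (sym (lookup∘tabulate _ v)) ([]=⇒lookup v∈)
  ... | yes fv≡i | _ = fv≡i

  part : Vec (Fin k) n → Fin k → SubDigraph n
  part f i = induced (lookup Bs i) (class f i)

  partition : Vec (Fin k) n → Vec (SubDigraph n) k
  partition f = tabulate (part f)

  part-∈ : ∀ f {i v} → v ∈ verts (lookup (partition f) i) → lookup f v ≡ i
  part-∈ f {i} v∈ = ∈-class⁻ f (subst (λ P → _ ∈ verts P) (lookup∘tabulate (part f) i) v∈)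

  ∈-part : ∀ f {i v} → lookup f v ≡ i → v ∈ verts (lookup (partition f) i)
  ∈-part f {i} fv≡i = subst (λ P → _ ∈ verts P) (sym (lookup∘tabulate (part f) i)) (∈-class⁺ f fv≡i)

  part-IsBPartition : ∀ {f} → Valid f → IsBPartition G Bs (partition f)
  part-IsBPartition {f} valid =
    (λ i → subst (λ P → IsInducedSubOf P (whole G)) (sym (lookup∘tabulate (part f) i)) (induced-in-G i)) ,
    (λ i → subst (λ P → IsInducedSubOf P (lookup Bs i)) (sym (lookup∘tabulate (part f) i)) (induced-in-B i)) ,
    λ v → lookup f v , ∈-part f refl , λ j v∈ → sym (part-∈ f v∈)
    where
    class⊆B : ∀ i → class f i ⊆ verts (lookup Bs i)
    class⊆B i v∈ = subst (λ j → _ ∈ verts (lookup Bs j)) (∈-class⁻ f v∈) (valid _)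
    B≼G : ∀ i → lookup Bs i ≼ whole G
    B≼G i = IsSubOf⇒≼ {H = lookup Bs i} {K = whole G} (proj₁ (Bs-induced i))
    induced-in-B : ∀ i → IsInducedSubOf (part f i) (lookup Bs i)
    induced-in-B i = ≼⇒IsSubOf {K = lookup Bs i} (induced-WellFormed {H = lookup Bs i}) (induced-≼ (class⊆B i)) ,
                     λ _ _ u∈ w∈ e → unE (induced-E⁺ {H = lookup Bs i} u∈ w∈ (mkE e))
    induced-in-G : ∀ i → IsInducedSubOf (part f i) (whole G)
    induced-in-G i =
      ≼⇒IsSubOf {K = whole G} (induced-WellFormed {H = lookup Bs i}) (≼-trans (induced-≼ (class⊆B i)) (B≼G i)) ,
      λ u w u∈ w∈ e → proj₂ (induced-in-B i) u w u∈ w∈ (proj₂ (Bs-induced i) u w (class⊆B i u∈) (class⊆B i w∈) e)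

  partition-injective : ∀ {f g} → partition f ≡ partition g → f ≡ g
  partition-injective {f} {g} f≡g = vec-ext λ v →
    sym (part-∈ g (subst (λ P → v ∈ verts (lookup P (lookup f v))) f≡g (∈-part f refl)))

  IsBPartition⇒partition : ∀ {P} → IsBPartition G Bs P → Σ (Vec (Fin k) n) λ f → Valid f × P ≡ partition f
  IsBPartition⇒partition {P} (_ , P-induced , cover) =
    f , valid , vec-ext λ i → trans (Pᵢ≡part i) (sym (lookup∘tabulate (part f) i))
    where
    f : Vec (Fin k) n
    f = tabulate λ v → proj₁ (cover v)
    ∈P⇒ : ∀ {i v} → v ∈ verts (lookup P i) → lookup f v ≡ i
    ∈P⇒ {i} {v} v∈ = trans (lookup∘tabulate _ v) (sym (proj₂ (proj₂ (cover v)) i v∈))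
    ⇒∈P : ∀ {i v} → lookup f v ≡ i → v ∈ verts (lookup P i)
    ⇒∈P {i} {v} fv≡i =
      subst (λ j → v ∈ verts (lookup P j)) (trans (sym (lookup∘tabulate _ v)) fv≡i) (proj₁ (proj₂ (cover v)))
    valid : Valid f
    valid v = proj₁ (proj₁ (P-induced (lookup f v))) (⇒∈P refl)
    Pᵢ≡part : ∀ i → lookup P i ≡ part f i
    Pᵢ≡part i = SubDigraph-ext (λ p → mkV (∈-class⁺ f (∈P⇒ (unV p)))) (λ p → mkV (⇒∈P (∈-class⁻ f (unV p))))
      (λ e → let a∈ , b∈ = IsSubOf⇒WellFormed {H = lookup P i} {K = lookup Bs i} sub e in
             induced-E⁺ {H = lookup Bs i} (∈-class⁺ f (∈P⇒ (unV a∈))) (∈-class⁺ f (∈P⇒ (unV b∈)))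
                        (≼-E (IsSubOf⇒≼ {H = lookup P i} {K = lookup Bs i} sub) e))
      (λ e → let a∈ , b∈ , e′ = induced-E⁻ {H = lookup Bs i} e in
             mkE (proj₂ (P-induced i) _ _ (⇒∈P (∈-class⁻ f a∈)) (⇒∈P (∈-class⁻ f b∈)) (unE e′)))
      where sub = proj₁ (P-induced i)

  numBPartitions : NumBPartitions G Bs (product (List.tabulate (cutIndex Bs)))
  numBPartitions = List.map partition candidates ,
    Unique.map⁺ partition-injective (choices-unique n (blocksAt-unique Bs)) ,
    All.tabulate (λ P∈ → let f , f∈ , P≡ = ∈-map⁻ partition P∈ in
      subst (IsBPartition G Bs) (sym P≡) (part-IsBPartition {f} λ v → ∈-blocksAt⁻ Bs (∈-choices⁻ n f∈ v))) ,
    (λ P isP → let f , valid , P≡ = IsBPartition⇒partition isP in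
      subst (_∈ˡ List.map partition candidates) (sym P≡)
            (∈-map⁺ partition (∈-choices⁺ n f λ v → ∈-blocksAt⁺ Bs (lookup f v) (valid v)))) ,
    (begin
      length (List.map partition candidates)         ≡⟨ length-map partition candidates ⟩
      length candidates                              ≡⟨ length-choices n (blocksAt Bs) ⟩
      product (List.tabulate (length ∘ blocksAt Bs)) ≡⟨ cong product (List.tabulate-cong (length-blocksAt Bs)) ⟩
      product (List.tabulate (cutIndex Bs))          ∎)
    where
    open ≡-Reasoning
    candidates = choices n (blocksAt Bs)

product-tabulate-lookup : ∀ {t} (h : Fin n → ℕ) (cs : Vec (Fin n) t) →
                          product (List.tabulate (h ∘ lookup cs)) ≡ prodV (map h cs)
product-tabulate-lookup h []       = refl
product-tabulate-lookup h (c ∷ cs) = cong (h c *_) (product-tabulate-lookup h cs)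

module CutIndices {n k t} (G : Digraph n) (Bs : Vec (SubDigraph n) k) (cs : Vec (Fin n) t)
                  (blocks : AreTheBlocks G Bs) (cuts : AreTheCutVertices G cs) where
  open Blocks G

  cutIndex-nonCut : ∀ v → (∀ l → lookup cs l ≢ v) → cutIndex Bs v ≡ 1
  cutIndex-nonCut v ¬cut = trans (sym (length-blocksAt Bs v)) (≤-antisym at-most-one at-least-one)
    where
    at-least-one : 1 ≤ length (blocksAt Bs v)
    at-least-one with anyFin? (λ i → v ∈? verts (lookup Bs i))
    ... | yes (i , v∈) = ∈⇒length-≥1 (∈-blocksAt⁺ Bs i v∈)
    ... | no  none     = ⊥-elim (¬¬-Block-at v λ (B , blk , v∈B) →
      let i , Bᵢ≡B = proj₁ (proj₂ blocks) B blk in none (i , subst (λ D → v ∈ verts D) (sym Bᵢ≡B) (unV v∈B)))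
    at-most-one : length (blocksAt Bs v) ≤ 1
    at-most-one = length-≤1 (blocksAt-unique Bs v) λ {i} {j} i∈ j∈ → decidable-stable (i ≟ j) λ i≢j →
      ¬¬-shared⇒cut (proj₁ blocks i) (proj₁ blocks j) (i≢j ∘ proj₂ (proj₂ blocks) i j)
                    (mkV (∈-blocksAt⁻ Bs i∈)) (mkV (∈-blocksAt⁻ Bs j∈))
        λ cut → let l , csₗ≡v = proj₁ (proj₂ cuts) v cut in ¬cut l csₗ≡v

  product-cutIndex : product (List.tabulate (cutIndex Bs)) ≡ prodV (map (cutIndex Bs) cs)
  product-cutIndex = begin
    product (List.tabulate (cutIndex Bs))             ≡⟨ cong product (List.map-tabulate id (cutIndex Bs)) ⟨
    product (List.map (cutIndex Bs) (List.allFin n))  ≡⟨ product-map-⊆ (cutIndex Bs) cut-list (allFin⁺ n) cut-list-unique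
                                                           (λ _ → ∈-allFin _) (λ _ → non-cut-trivial) ⟩
    product (List.map (cutIndex Bs) cut-list)         ≡⟨ cong product (List.map-tabulate (lookup cs) (cutIndex Bs)) ⟩
    product (List.tabulate (cutIndex Bs ∘ lookup cs)) ≡⟨ product-tabulate-lookup (cutIndex Bs) cs ⟩
    prodV (map (cutIndex Bs) cs)                      ∎
    where
    open ≡-Reasoning
    cut-list = List.tabulate (lookup cs)
    cut-list-unique : Unique cut-list
    cut-list-unique = tabulate⁺ (λ {i} {j} → proj₂ (proj₂ cuts) i j)
    non-cut-trivial : ∀ {v} → v ∉ˡ cut-list → cutIndex Bs v ≡ 1
    non-cut-trivial {v} v∉ = cutIndex-nonCut v λ l csₗ≡v → v∉ (subst (_∈ˡ cut-list) csₗ≡v (∈-tabulate⁺ l))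

mainTheorem1 : ∀ (n k t : ℕ) (G : Digraph n) (Bs : Vec (SubDigraph n) k)
                 (cs : Vec (Fin n) t) →
                 AreTheBlocks G Bs → AreTheCutVertices G cs →
                 NumBPartitions G Bs (prodV (map (cutIndex Bs) cs))
mainTheorem1 n k t G Bs cs blocks cuts =
  subst (NumBPartitions G Bs) (CutIndices.product-cutIndex G Bs cs blocks cuts)
        (Partitions.numBPartitions G Bs (Blocks.Block-IsInducedSubOf G ∘ proj₁ blocks))
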